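{- Let $G,H$ be finite simple connected graphs, fix a root $(r_G,r_H)\in V(G\,\square\,H)$, let $K\in\{G,H\}$ with $\bar K$ the other graph, let $v\in V(\bar K)$ and $\eta\in\{1,2,\dots,\pi(\bar K)\}$. Let $S\subseteq V(\bar K)\setminus\{v\}$ satisfy \[ d:=\max_{w\in S} D_{\bar K}(v,w)\ \le\ \lceil \log_2 \pi(K)\rceil-1 \quad\text{and}\quad \eta\le |S|\le \pi(\bar K), \] and put $\chi=(2^d-1)+|S|-\eta$ and $M=2\pi(G)\pi(H)$. Then every configuration $c$ on $G\,\square\,H$ from which no sequence of pebbling moves places a pebble on $(r_G,r_H)$ satisfies \[ |K|(|S|-\eta)+extra_{K,v}+1\ \le\ \sum_{w\in S}2^{D_{\bar K}(v,w)}\bigl(\pi(K)-extra_{K,w}\bigr)+M\bigl(1-x_{K,v,\chi}\bigr)+M\bigl(1-y_{K,\pi(\bar K)-\eta}\bigr). \]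
   Context: The Cartesian product $G\,\square\,H$ has vertex set $V(G)\times V(H)$, with $(g,h)\sim(g',h')$ iff ($g=g'$ and $h\sim_H h'$) or ($h=h'$ and $g\sim_G g'$). $D_X$ denotes graph distance in $X$ and $|X|$ the number of vertices. A configuration is a function $c:V(G\,\square\,H)\to\mathbb{Z}_{\ge0}$. A pebbling move removes two pebbles from a vertex and adds one to an adjacent vertex. $\pi(X)$ (pebbling number) is the least $k$ such that from every configuration of size $k$ on $X$ and every root some sequence of pebbling moves places a pebble on the root. For $K\in\{G,H\}$, $\bar K$ is the other graph; for $j\in V(\bar K)$ the $K$-slice $K_j$ is $\{(i,j):i\in V(G)\}$ if $K=G$ and $\{(j,h):h\in V(H)\}$ if $K=H$. For a configuration $c$: $\tilde c_{K,j}=\sum_{u\in K_j}c(u)$; $set_{K,j}=\lfloor\tilde c_{K,j}/\pi(K)\rfloor$; $extra_{K,j}=\tilde c_{K,j}-\pi(K)\,set_{K,j}$; $sat_{K,j}=\lfloor(\tilde c_{K,j}-extra_{K,j})/|K|\rfloor$; $x_{K,j,t}=1$ if $sat_{K,j}\ge t$ and $0$ otherwise; $y_{K,s}=1$ if $\sum_{j\in V(\bar K)}set_{K,j}\ge s$ and $0$ otherwise. -}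

module Defs where

open import Data.Nat using (ℕ; zero; suc; _+_; _*_; _∸_; _^_; _≤_; _<_; _⊔_; _≤?_)
open import Data.Nat.DivMod using (_/_)
open import Data.Bool using (Bool; true; false; T; if_then_else_; _∧_; _∨_)
open import Data.Fin using (Fin; zero; suc; combine; remQuot; _≟_)
open import Data.Fin.Subset using (Subset)
open import Data.Vec using (lookup)
open import Data.Product using (Σ; ∃; _×_; _,_; proj₁; proj₂)
open import Relation.Nullary using (¬_)
open import Relation.Nullary.Decidable using (⌊_⌋)
open import Relation.Binary.PropositionalEquality using (_≡_)
open import Relation.Binary.Construct.Closure.ReflexiveTransitive using (Star)

record Graph : Set where
  field
    n : ℕ
    E : Fin n → Fin n → Bool
open Graph public

Adj : (G : Graph) → Fin (n G) → Fin (n G) → Set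
Adj G u w = T (E G u w)

SimpleGraph : Graph → Set
SimpleGraph G = (∀ u → E G u u ≡ false) × (∀ u w → E G u w ≡ E G w u)

data Walk (G : Graph) : Fin (n G) → Fin (n G) → ℕ → Set where
  here : ∀ {u} → Walk G u u 0
  step : ∀ {u x w ℓ} → Adj G u x → Walk G x w ℓ → Walk G u w (suc ℓ)

Connected : Graph → Set
Connected G = ∀ u w → ∃ λ ℓ → Walk G u w ℓ

IsDistance : (G : Graph) → (Fin (n G) → Fin (n G) → ℕ) → Set
IsDistance G D = ∀ u w → Walk G u w (D u w) × (∀ ℓ → Walk G u w ℓ → D u w ≤ ℓ)

sumFin : ∀ m → (Fin m → ℕ) → ℕ
sumFin zero f = 0
sumFin (suc m) f = f zero + sumFin m (λ i → f (suc i))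

maxFin : ∀ m → (Fin m → ℕ) → ℕ
maxFin zero f = 0
maxFin (suc m) f = f zero ⊔ maxFin m (λ i → f (suc i))

-- max over the members of a subset S (S nonempty in our use)
maxIn : ∀ {m} → Subset m → (Fin m → ℕ) → ℕ
maxIn {m} S f = maxFin m (λ i → if lookup S i then f i else 0)

sumIn : ∀ {m} → Subset m → (Fin m → ℕ) → ℕ
sumIn {m} S f = sumFin m (λ i → if lookup S i then f i else 0)

Conf : Graph → Set
Conf G = Fin (n G) → ℕ

size : (G : Graph) → Conf G → ℕ
size G c = sumFin (n G) c

ind : ∀ {m} → Fin m → Fin m → ℕ → ℕ
ind x u k = if ⌊ x ≟ u ⌋ then k else 0

data Move (G : Graph) : Conf G → Conf G → Set where
  move : ∀ c u w → Adj G u w → 2 ≤ c u →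
         Move G c (λ x → (c x ∸ ind x u 2) + ind x w 1)

Reach : (G : Graph) → Conf G → Conf G → Set
Reach G = Star (Move G)

Solvable : (G : Graph) → Conf G → Fin (n G) → Set
Solvable G c r = ∃ λ c' → Reach G c c' × 1 ≤ c' r

PebblingProp : Graph → ℕ → Set
PebblingProp G k = ∀ (c : Conf G) → size G c ≡ k → ∀ r → Solvable G c r

IsPebblingNumber : Graph → ℕ → Set
IsPebblingNumber G p = PebblingProp G p × (∀ k → k < p → ¬ PebblingProp G k)

-- Cartesian product; vertex (g,h) is encoded as combine g h
_□_ : Graph → Graph → Graph
G □ H = record
  { n = n G * n H
  ; E = λ a b → let g = proj₁ (remQuot {n G} (n H) a) ; h = proj₂ (remQuot {n G} (n H) a)
                    g' = proj₁ (remQuot {n G} (n H) b) ; h' = proj₂ (remQuot {n G} (n H) b)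
                in (⌊ g ≟ g' ⌋ ∧ E H h h') ∨ (⌊ h ≟ h' ⌋ ∧ E G g g')
  }

data Side : Set where
  sideG sideH : Side

Kof : Side → Graph → Graph → Graph
Kof sideG G H = G
Kof sideH G H = H

Kbar : Side → Graph → Graph → Graph
Kbar sideG G H = H
Kbar sideH G H = G

sel : Side → ℕ → ℕ → ℕ
sel sideG a b = a
sel sideH a b = b

slice : (s : Side) (G H : Graph) → Conf (G □ H) →
        Fin (n (Kbar s G H)) → Fin (n (Kof s G H)) → ℕ
slice sideG G H c j i = c (combine i j)
slice sideH G H c j h = c (combine j h)

-- floor division; b is always ≥ 1 where used (value at 0 irrelevant)
div0 : ℕ → ℕ → ℕ
div0 a zero = 0
div0 a (suc b) = a / suc b

module Slices (s : Side) (G H : Graph) (πK : ℕ) (c : Conf (G □ H)) where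
  K  = Kof s G H
  Kb = Kbar s G H

  c~ : Fin (n Kb) → ℕ
  c~ j = sumFin (n K) (slice s G H c j)

  set : Fin (n Kb) → ℕ
  set j = div0 (c~ j) πK

  extra : Fin (n Kb) → ℕ
  extra j = c~ j ∸ πK * set j

  sat : Fin (n Kb) → ℕ
  sat j = div0 (c~ j ∸ extra j) (n K)

  x : Fin (n Kb) → ℕ → ℕ
  x j t = if ⌊ t ≤? sat j ⌋ then 1 else 0

  y : ℕ → ℕ
  y t = if ⌊ t ≤? sumFin (n Kb) set ⌋ then 1 else 0

-- Suppose the inequality fails for an unsolvable c. Then both indicators equal 1, and the slice K_v
-- holds at least |K|(2^d − 1) + Σ_{w∈S} 2^{D(v,w)} (π(K) − extra_w) pebbles. While K_v keeps more than
-- |K|(2^d − 1) pebbles, some vertex of it carries 2^{D(v,w)} of them, and a walk in K̄ turns these into one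
-- pebble on K_w; this tops every K_w with w ∈ S up to one more multiple of π(K), at a cost to K_v of at most
-- |K|(|S| − η) + extra_v ≤ π(K)(|S| − η) + extra_v pebbles. The slices then hold π(K̄) disjoint sets of π(K)
-- pebbles, each set sends one pebble to the K̄-fibre through r_K, and that fibre sends one to the root.
-- If an indicator is 0, the right-hand side is at least M, which already exceeds the left-hand side.

module Submission where

open import Defs
import Algebra.Properties.CommutativeMonoid.Sum as Sum
open import Data.Bool using (Bool; true; false; T; if_then_else_; _∧_; _∨_)
open import Data.Bool.Properties using (T-∧; T-∨)
open import Data.Empty using (⊥-elim)
open import Data.Fin using (Fin; zero; suc; _≟_; combine; remQuot; quotRem)
open import Data.Fin.Properties using (suc-injective; nonZeroIndex; remQuot-combine; combine-remQuot)
open import Data.Fin.Subset using (Subset; _∉_; ∣_∣)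
open import Data.Nat using (ℕ; zero; suc; _+_; _*_; _∸_; _^_; _≤_; _<_; z≤n; s≤s; _≤?_; _<?_; >-nonZero⁻¹)
open import Data.Nat.DivMod using (_/_; _%_; m/n*n≤m; m≡m%n+[m/n]*n; m%n<n)
open import Data.Nat.Logarithm using (⌈log₂_⌉)
open import Data.Nat.Properties hiding (_≟_; suc-injective)
open import Data.Product using (∃; _×_; _,_; proj₁; proj₂) renaming (swap to ×-swap)
open import Data.Sum using (_⊎_; inj₁; inj₂)
open import Data.Vec using (_∷_; []; lookup)
open import Data.Vec.Properties using (lookup⇒[]=)
open import Function using (_∘_)
open import Function.Bundles using (Equivalence)
open import Relation.Binary.Construct.Closure.ReflexiveTransitive using (ε; _◅_; _◅◅_)
open import Relation.Binary.PropositionalEquality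
open import Relation.Nullary using (¬_; yes; no)
open import Relation.Nullary.Decidable using (⌊_⌋; fromWitness)

open Sum +-0-commutativeMonoid using (sum; ∑-distrib-+)

infix 4 _≼_
infixl 6 _⊕_

_≼_ : ∀ {m} → (Fin m → ℕ) → (Fin m → ℕ) → Set
f ≼ g = ∀ x → f x ≤ g x

_⊕_ : ∀ {m} → (Fin m → ℕ) → (Fin m → ℕ) → Fin m → ℕ
(f ⊕ g) x = f x + g x

≼-refl : ∀ {m} {f : Fin m → ℕ} → f ≼ f
≼-refl x = ≤-refl

≼-trans : ∀ {m} {f g h : Fin m → ℕ} → f ≼ g → g ≼ h → f ≼ h
≼-trans f≼g g≼h x = ≤-trans (f≼g x) (g≼h x)

point : ∀ {m} → Fin m → ℕ → Fin m → ℕ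
point u k x = ind x u k

module _ {m : ℕ} {u : Fin m} where

  point-at : ∀ k → point u k u ≡ k
  point-at k with u ≟ u
  ... | yes _ = refl
  ... | no u≢u = ⊥-elim (u≢u refl)

  point-off : ∀ {x} k → x ≢ u → point u k x ≡ 0
  point-off {x} k x≢u with x ≟ u
  ... | yes x≡u = ⊥-elim (x≢u x≡u)
  ... | no _ = refl

  point-≼ : ∀ {k c} → k ≤ c u → point u k ≼ c
  point-≼ k≤cu x with x ≟ u
  ... | yes refl = k≤cu
  ... | no _ = z≤n

  point-mono : ∀ {a b} → a ≤ b → point u a ≼ point u b
  point-mono a≤b x with x ≟ u
  ... | yes _ = a≤b
  ... | no _ = z≤n

  point-+ : ∀ a b x → point u (a + b) x ≡ (point u a ⊕ point u b) x
  point-+ a b x with x ≟ u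
  ... | yes _ = refl
  ... | no _ = refl

point-sym : ∀ {m} (u x : Fin m) k → point u k x ≡ point x k u
point-sym u x k with x ≟ u | u ≟ x
... | yes _ | yes _ = refl
... | no _ | no _ = refl
... | yes x≡u | no u≢x = ⊥-elim (u≢x (sym x≡u))
... | no x≢u | yes u≡x = ⊥-elim (x≢u (sym u≡x))

point-injective : ∀ {m m'} (f : Fin m → Fin m') → (∀ {a b} → f a ≡ f b → a ≡ b) →
                  ∀ u k x → point (f u) k (f x) ≡ point u k x
point-injective f f-inj u k x with x ≟ u
... | yes refl = point-at k
... | no x≢u = point-off k (x≢u ∘ f-inj)

sumFin-cong : ∀ m {f g : Fin m → ℕ} → (∀ i → f i ≡ g i) → sumFin m f ≡ sumFin m g
sumFin-cong zero f≗g = refl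
sumFin-cong (suc m) f≗g = cong₂ _+_ (f≗g zero) (sumFin-cong m (f≗g ∘ suc))

sumFin-mono : ∀ m {f g : Fin m → ℕ} → f ≼ g → sumFin m f ≤ sumFin m g
sumFin-mono zero f≼g = z≤n
sumFin-mono (suc m) f≼g = +-mono-≤ (f≼g zero) (sumFin-mono m (f≼g ∘ suc))

sumFin≡sum : ∀ m (f : Fin m → ℕ) → sumFin m f ≡ sum f
sumFin≡sum zero f = refl
sumFin≡sum (suc m) f = cong (f zero +_) (sumFin≡sum m (f ∘ suc))

sumFin-⊕ : ∀ m (f g : Fin m → ℕ) → sumFin m (f ⊕ g) ≡ sumFin m f + sumFin m g
sumFin-⊕ m f g = begin
  sumFin m (f ⊕ g)          ≡⟨ sumFin≡sum m (f ⊕ g) ⟩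
  sum (f ⊕ g)               ≡⟨ ∑-distrib-+ f g ⟩
  sum f + sum g             ≡⟨ sym (cong₂ _+_ (sumFin≡sum m f) (sumFin≡sum m g)) ⟩
  sumFin m f + sumFin m g   ∎
  where open ≡-Reasoning

sumFin-zero : ∀ m {f : Fin m → ℕ} → (∀ i → f i ≡ 0) → sumFin m f ≡ 0
sumFin-zero m f≗0 = trans (sumFin-cong m f≗0) (sumFin-const0 m)
  where
  sumFin-const0 : ∀ m → sumFin m (λ _ → 0) ≡ 0
  sumFin-const0 zero = refl
  sumFin-const0 (suc m) = sumFin-const0 m

sumFin-points : ∀ m (f : Fin m → ℕ) j → sumFin m (λ k → point k (f k) j) ≡ f j
sumFin-points (suc m) f zero = begin
  f zero + sumFin m (λ k → point (suc k) (f (suc k)) zero)   ≡⟨ cong (f zero +_) (sumFin-zero m (λ k → point-off {u = suc k} {x = zero} (f (suc k)) λ ())) ⟩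
  f zero + 0                                                  ≡⟨ +-identityʳ (f zero) ⟩
  f zero                                                      ∎
  where open ≡-Reasoning
sumFin-points (suc m) f (suc j) = trans
  (sumFin-cong m (λ k → point-injective suc suc-injective k (f (suc k)) j))
  (sumFin-points m (f ∘ suc) j)

sumFin-point : ∀ m (u : Fin m) k → sumFin m (point u k) ≡ k
sumFin-point m u k = trans (sumFin-cong m (λ x → point-sym u x k)) (sumFin-points m (λ _ → k) u)

sumFin-one : ∀ m → sumFin m (λ _ → 1) ≡ m
sumFin-one zero = refl
sumFin-one (suc m) = cong suc (sumFin-one m)

sumIn-one : ∀ {m} (S : Subset m) → sumIn S (λ _ → 1) ≡ ∣ S ∣
sumIn-one [] = refl
sumIn-one (true ∷ S) = cong suc (sumIn-one S)
sumIn-one (false ∷ S) = sumIn-one S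

pigeonhole : ∀ m (f : Fin m → ℕ) a → m * a < sumFin m f → ∃ λ i → a < f i
pigeonhole (suc m) f a m*a<Σf with a <? f zero
... | yes a<f0 = zero , a<f0
... | no a≮f0 =
  let i , a<fi = pigeonhole m (f ∘ suc) a (+-cancelˡ-< a _ _ (<-≤-trans m*a<Σf (+-monoˡ-≤ _ (≮⇒≥ a≮f0))))
  in suc i , a<fi

shrink : ∀ m (f : Fin m → ℕ) k → k ≤ sumFin m f → ∃ λ g → g ≼ f × sumFin m g ≡ k
shrink zero f zero _ = f , ≼-refl , refl
shrink (suc m) f k k≤Σf with k ≤? f zero
... | yes k≤f0 = point zero k , point-≼ k≤f0 , sumFin-point (suc m) zero k
... | no k≰f0 =
  let g , g≼f , Σg≡ = shrink m (f ∘ suc) (k ∸ f zero) (m≤n+o⇒m∸n≤o k (f zero) k≤Σf)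
  in (λ { zero → f zero ; (suc i) → g i })
   , (λ { zero → ≤-refl ; (suc i) → g≼f i })
   , trans (cong (f zero +_) Σg≡) (m+[n∸m]≡n (≰⇒≥ k≰f0))

*-div0-≤ : ∀ a p → p * div0 a p ≤ a
*-div0-≤ a zero = z≤n
*-div0-≤ a (suc p) = ≤-trans (≤-reflexive (*-comm (suc p) (a / suc p))) (m/n*n≤m a (suc p))

∸-*-div0-< : ∀ a p → 1 ≤ p → a ∸ p * div0 a p < p
∸-*-div0-< a (suc p) _ = subst (_< suc p) (sym remainder) (m%n<n a (suc p))
  where
  remainder : a ∸ suc p * (a / suc p) ≡ a % suc p
  remainder = begin
    a ∸ suc p * (a / suc p)                            ≡⟨ cong₂ _∸_ (m≡m%n+[m/n]*n a (suc p)) (*-comm (suc p) (a / suc p)) ⟩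
    a % suc p + a / suc p * suc p ∸ a / suc p * suc p  ≡⟨ m+n∸n≡m (a % suc p) (a / suc p * suc p) ⟩
    a % suc p                                          ∎
    where open ≡-Reasoning

maxFin-ub : ∀ m (f : Fin m → ℕ) i → f i ≤ maxFin m f
maxFin-ub (suc m) f zero = m≤m⊔n (f zero) _
maxFin-ub (suc m) f (suc i) = ≤-trans (maxFin-ub m (f ∘ suc) i) (m≤n⊔m (f zero) _)

maxIn-ub : ∀ {m} (S : Subset m) (f : Fin m → ℕ) {i} → lookup S i ≡ true → f i ≤ maxIn S f
maxIn-ub {m} S f {i} i∈S = subst (_≤ maxIn S f) (cong (λ b → if b then f i else 0) i∈S)
  (maxFin-ub m (λ j → if lookup S j then f j else 0) i)

∉⇒lookup≡false : ∀ {m} (S : Subset m) {i} → i ∉ S → lookup S i ≡ false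
∉⇒lookup≡false S {i} i∉S with lookup S i in eq
... | true = ⊥-elim (i∉S (lookup⇒[]= i S eq))
... | false = refl

indicator-cases : ∀ a b → (if ⌊ a ≤? b ⌋ then 1 else 0) ≡ 0 ⊎ a ≤ b
indicator-cases a b with a ≤? b
... | yes a≤b = inj₂ a≤b
... | no _ = inj₁ refl

-- Reachability up to domination

Reaches : (G : Graph) → Conf G → Conf G → Set
Reaches G c d = ∃ λ c' → Reach G c c' × d ≼ c'

private
  ∸-+-frame : ∀ {a e f} i j → i ≤ a → a + e ≤ f → (a ∸ i + j) + e ≤ (f ∸ i) + j
  ∸-+-frame {a} {e} {f} i j i≤a a+e≤f = begin
    (a ∸ i + j) + e   ≡⟨ +-assoc (a ∸ i) j e ⟩
    a ∸ i + (j + e)   ≡⟨ cong (a ∸ i +_) (+-comm j e) ⟩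
    a ∸ i + (e + j)   ≡⟨ +-assoc (a ∸ i) e j ⟨
    (a ∸ i + e) + j   ≡⟨ cong (_+ j) (+-∸-comm e i≤a) ⟨
    (a + e ∸ i) + j   ≤⟨ +-monoˡ-≤ j (∸-monoˡ-≤ i a+e≤f) ⟩
    (f ∸ i) + j       ∎
    where open ≤-Reasoning

module _ {G : Graph} where

  -- Moves stay legal on any configuration with more pebbles, and leave the surplus untouched.
  reach-frame : ∀ {c c' e f} → Reach G c c' → c ⊕ e ≼ f → Reaches G f (c' ⊕ e)
  reach-frame {f = f} ε c⊕e≼f = f , ε , c⊕e≼f
  reach-frame {e = e} {f} (move c u w u~w 2≤cu ◅ steps) c⊕e≼f =
    let f' , f⇝f' , c'⊕e≼f' = reach-frame steps λ x →
          ∸-+-frame {e = e x} (point u 2 x) (point w 1 x) (point-≼ 2≤cu x) (c⊕e≼f x)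
    in f' , move f u w u~w (≤-trans 2≤cu (≤-trans (m≤m+n (c u) (e u)) (c⊕e≼f u))) ◅ f⇝f' , c'⊕e≼f'

  reaches-refl : ∀ c → Reaches G c c
  reaches-refl c = c , ε , ≼-refl

  reaches-weaken : ∀ {c d d'} → d' ≼ d → Reaches G c d → Reaches G c d'
  reaches-weaken d'≼d (c' , c⇝c' , d≼c') = c' , c⇝c' , ≼-trans d'≼d d≼c'

  reaches-trans : ∀ {c d e} → Reaches G c d → Reaches G d e → Reaches G c e
  reaches-trans {d = d} (c₁ , c⇝c₁ , d≼c₁) (d₁ , d⇝d₁ , e≼d₁) =
    let f , c₁⇝f , d₁⊕r≼f = reach-frame {e = λ x → c₁ x ∸ d x} d⇝d₁ (λ x → ≤-reflexive (m+[n∸m]≡n (d≼c₁ x)))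
    in f , c⇝c₁ ◅◅ c₁⇝f , λ x → ≤-trans (≤-trans (e≼d₁ x) (m≤m+n _ _)) (d₁⊕r≼f x)

  reaches-mono : ∀ {c c' d} → c ≼ c' → Reaches G c d → Reaches G c' d
  reaches-mono c≼c' = reaches-trans (_ , ε , c≼c')

  reaches-frame : ∀ {c d} e → Reaches G c d → Reaches G (c ⊕ e) (d ⊕ e)
  reaches-frame e (c' , c⇝c' , d≼c') =
    reaches-weaken (λ x → +-monoˡ-≤ (e x) (d≼c' x)) (reach-frame c⇝c' ≼-refl)

  reaches-⊕ : ∀ {a b a' b'} → Reaches G a b → Reaches G a' b' → Reaches G (a ⊕ a') (b ⊕ b')
  reaches-⊕ {b = b} {a' = a'} a⇝b a'⇝b' = reaches-trans (reaches-frame a' a⇝b)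
    (reaches-mono (λ x → ≤-reflexive (+-comm (a' x) (b x)))
      (reaches-weaken (λ x → ≤-reflexive (+-comm (b x) _)) (reaches-frame b a'⇝b')))

  reaches-sumFin : ∀ m (c d : Fin m → Conf G) → (∀ j → Reaches G (c j) (d j)) →
                   Reaches G (λ x → sumFin m (λ j → c j x)) (λ x → sumFin m (λ j → d j x))
  reaches-sumFin zero c d _ = reaches-refl _
  reaches-sumFin (suc m) c d c⇝d = reaches-⊕ (c⇝d zero) (reaches-sumFin m (c ∘ suc) (d ∘ suc) (c⇝d ∘ suc))

  reaches-move : ∀ c {u w} → Adj G u w → 2 ≤ c u → Reaches G c (λ x → (c x ∸ point u 2 x) + point w 1 x)
  reaches-move c u~w 2≤cu = _ , move c _ _ u~w 2≤cu ◅ ε , ≼-refl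

  reaches⇒solvable : ∀ {c} r → Reaches G c (point r 1) → Solvable G c r
  reaches⇒solvable r (c' , c⇝c' , r≼c') = c' , c⇝c' , subst (_≤ c' r) (point-at 1) (r≼c' r)

  solvable⇒reaches : ∀ {c} r → Solvable G c r → Reaches G c (point r 1)
  solvable⇒reaches r (c' , c⇝c' , 1≤c'r) = c' , c⇝c' , point-≼ 1≤c'r

  reaches-halve : ∀ {u w} → Adj G u w → ∀ k → Reaches G (point u (2 * k)) (point w k)
  reaches-halve u~w zero = reaches-weaken (point-≼ z≤n) (reaches-refl _)
  reaches-halve {u} {w} u~w (suc k) =
    reaches-trans (reaches-weaken one-moved (reaches-move _ u~w 2≤))
      (reaches-weaken (λ x → ≤-reflexive (point-+ 1 k x)) (reaches-⊕ (reaches-refl (point w 1)) (reaches-halve u~w k)))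
    where
    2≤ : 2 ≤ point u (2 * suc k) u
    2≤ = subst (2 ≤_) (sym (point-at (2 * suc k))) (*-monoʳ-≤ 2 (s≤s z≤n))
    one-moved : point w 1 ⊕ point u (2 * k) ≼ λ x → (point u (2 * suc k) x ∸ point u 2 x) + point w 1 x
    one-moved x = ≤-reflexive (begin
      point w 1 x + point u (2 * k) x                       ≡⟨ +-comm (point w 1 x) _ ⟩
      point u (2 * k) x + point w 1 x                       ≡⟨ cong (_+ point w 1 x) (m+n∸m≡n (point u 2 x) _) ⟨
      (point u 2 x + point u (2 * k) x ∸ point u 2 x) + point w 1 x
                                                            ≡⟨ cong (λ t → (t ∸ point u 2 x) + point w 1 x) (point-+ 2 (2 * k) x) ⟨
      (point u (2 + 2 * k) x ∸ point u 2 x) + point w 1 x   ≡⟨ cong (λ t → (point u t x ∸ point u 2 x) + point w 1 x) (*-suc 2 k) ⟨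
      (point u (2 * suc k) x ∸ point u 2 x) + point w 1 x   ∎)
      where open ≡-Reasoning

  reaches-walk : ∀ {u w ℓ} → Walk G u w ℓ → ∀ k → Reaches G (point u (k * 2 ^ ℓ)) (point w k)
  reaches-walk here k = reaches-weaken (point-mono (≤-reflexive (sym (*-identityʳ k)))) (reaches-refl _)
  reaches-walk (step {ℓ = ℓ} u~x walk) k =
    reaches-trans (reaches-mono (point-mono (≤-reflexive k2^ℓ⁺¹≡)) (reaches-halve u~x (k * 2 ^ ℓ))) (reaches-walk walk k)
    where
    k2^ℓ⁺¹≡ : 2 * (k * 2 ^ ℓ) ≡ k * 2 ^ suc ℓ
    k2^ℓ⁺¹≡ = trans (sym (*-assoc 2 k _)) (trans (cong (_* 2 ^ ℓ) (*-comm 2 k)) (*-assoc k 2 _))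

module _ {G : Graph} {p : ℕ} (peb : PebblingProp G p) where

  reaches-pebbles : ∀ r k f → p * k ≤ size G f → Reaches G f (point r k)
  reaches-pebbles r zero f _ = reaches-weaken (point-≼ z≤n) (reaches-refl f)
  reaches-pebbles r (suc k) f p+pk≤f =
    reaches-mono (λ x → ≤-reflexive (m+[n∸m]≡n (g≼f x)))
      (reaches-weaken (λ x → ≤-reflexive (point-+ 1 k x))
        (reaches-⊕ (solvable⇒reaches r (peb g Σg≡p r)) (reaches-pebbles r k rest pk≤rest)))
    where
    shrunk = shrink (n G) f p (≤-trans (m≤m+n p (p * k)) (≤-trans (≤-reflexive (sym (*-suc p k))) p+pk≤f))
    g = proj₁ shrunk
    g≼f = proj₁ (proj₂ shrunk)
    Σg≡p = proj₂ (proj₂ shrunk)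
    rest : Conf G
    rest x = f x ∸ g x
    split : p + size G rest ≡ size G f
    split = trans (cong (_+ size G rest) (sym Σg≡p))
              (trans (sym (sumFin-⊕ (n G) g rest)) (sumFin-cong (n G) (λ x → m+[n∸m]≡n (g≼f x))))
    pk≤rest : p * k ≤ size G rest
    pk≤rest = +-cancelˡ-≤ p _ _ (≤-trans (≤-reflexive (sym (*-suc p k))) (≤-trans p+pk≤f (≤-reflexive (sym split))))

sparse-unsolvable : ∀ {G : Graph} {c r} → (∀ x → c x ≤ 1) → c r ≡ 0 → ¬ Solvable G c r
sparse-unsolvable c≤1 cr≡0 (_ , ε , 1≤cr) = 1+n≰n (subst (1 ≤_) cr≡0 1≤cr)
sparse-unsolvable c≤1 cr≡0 (_ , move _ u _ _ 2≤cu ◅ _ , _) = 1+n≰n (≤-trans 2≤cu (c≤1 u))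

-- One pebble on every vertex except r is an unsolvable configuration of n G − 1 pebbles.
order≤pebbling : ∀ {G : Graph} {p} → PebblingProp G p → Fin (n G) → n G ≤ p
order≤pebbling {G} {p} peb r with n G ≤? p
... | yes nG≤p = nG≤p
... | no nG≰p = ⊥-elim (sparse-unsolvable g≤1 gr≡0 (peb g Σg≡p r))
  where
  f : Conf G
  f x = 1 ∸ point r 1 x
  size+1 : size G f + 1 ≡ n G
  size+1 = begin
    size G f + 1                       ≡⟨ cong (size G f +_) (sumFin-point (n G) r 1) ⟨
    size G f + size G (point r 1)      ≡⟨ sumFin-⊕ (n G) f (point r 1) ⟨
    sumFin (n G) (f ⊕ point r 1)       ≡⟨ sumFin-cong (n G) (λ x → m∸n+n≡m (point-≼ {u = r} {c = λ _ → 1} ≤-refl x)) ⟩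
    sumFin (n G) (λ _ → 1)             ≡⟨ sumFin-one (n G) ⟩
    n G                                ∎
    where open ≡-Reasoning
  p≤f : p ≤ size G f
  p≤f = +-cancelʳ-≤ 1 p _ (≤-trans (≤-reflexive (+-comm p 1)) (≤-trans (≰⇒> nG≰p) (≤-reflexive (sym size+1))))
  shrunk = shrink (n G) f p p≤f
  g = proj₁ shrunk
  Σg≡p = proj₂ (proj₂ shrunk)
  g≤1 : ∀ x → g x ≤ 1
  g≤1 x = ≤-trans (proj₁ (proj₂ shrunk) x) (m∸n≤m 1 (point r 1 x))
  gr≡0 : g r ≡ 0
  gr≡0 = n≤0⇒n≡0 (≤-trans (proj₁ (proj₂ shrunk) r) (≤-reflexive (cong (1 ∸_) (point-at {u = r} 1))))

-- Products of graphs

-- An abstract product, so that both orientations of G □ H (K = G or K = H) are handled at once.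
record Product (A B X : Graph) : Set where
  field
    pair : Fin (n A) → Fin (n B) → Fin (n X)
    fst  : Fin (n X) → Fin (n A)
    snd  : Fin (n X) → Fin (n B)
    fst-pair : ∀ a b → fst (pair a b) ≡ a
    snd-pair : ∀ a b → snd (pair a b) ≡ b
    pair-fst-snd : ∀ x → pair (fst x) (snd x) ≡ x
    adjˡ : ∀ {a a'} b → Adj A a a' → Adj X (pair a b) (pair a' b)
    adjʳ : ∀ a {b b'} → Adj B b b' → Adj X (pair a b) (pair a b')

swap : ∀ {A B X} → Product A B X → Product B A X
swap P = record
  { pair = λ b a → pair a b ; fst = snd ; snd = fst
  ; fst-pair = λ b a → snd-pair a b ; snd-pair = λ b a → fst-pair a b
  ; pair-fst-snd = pair-fst-snd ; adjˡ = λ a → adjʳ a ; adjʳ = λ b → adjˡ b }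
  where open Product P

module Fibers {A B X : Graph} (P : Product A B X) where
  open Product P

  pair-injective₁ : ∀ {a a' b b'} → pair a b ≡ pair a' b' → a ≡ a'
  pair-injective₁ {a} {a'} {b} {b'} eq = trans (sym (fst-pair a b)) (trans (cong fst eq) (fst-pair a' b'))

  pair-injective₂ : ∀ {a a' b b'} → pair a b ≡ pair a' b' → b ≡ b'
  pair-injective₂ {a} {a'} {b} {b'} eq = trans (sym (snd-pair a b)) (trans (cong snd eq) (snd-pair a' b'))

  on-pairs : (Q : Fin (n X) → Set) → (∀ a b → Q (pair a b)) → ∀ x → Q x
  on-pairs Q Q-pair x = subst Q (pair-fst-snd x) (Q-pair (fst x) (snd x))

  onFiber : Fin (n A) → Conf B → Conf X
  onFiber a f x = point a (f (snd x)) (fst x)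

  restrict : Fin (n A) → Conf X → Conf B
  restrict a c b = c (pair a b)

  sliceSum : Fin (n A) → Conf X → ℕ
  sliceSum a c = size B (restrict a c)

  onFiber-point : ∀ a b k x → onFiber a (point b k) x ≡ point (pair a b) k x
  onFiber-point a b k = on-pairs _ λ a' b' → begin
    onFiber a (point b k) (pair a' b')   ≡⟨ cong₂ (λ i j → point a (point b k j) i) (fst-pair a' b') (snd-pair a' b') ⟩
    point a (point b k b') a'            ≡⟨ on-pair a' b' ⟩
    point (pair a b) k (pair a' b')      ∎
    where
    open ≡-Reasoning
    on-pair : ∀ a' b' → point a (point b k b') a' ≡ point (pair a b) k (pair a' b')
    on-pair a' b' with a' ≟ a
    ... | yes refl = sym (point-injective (pair a') pair-injective₂ b k b')
    ... | no a'≢a = sym (point-off k (a'≢a ∘ pair-injective₁))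

  onFiber-move : ∀ a f {u w} → Adj B u w → 2 ≤ f u →
                 Reaches X (onFiber a f) (onFiber a (λ y → (f y ∸ point u 2 y) + point w 1 y))
  onFiber-move a f {u} {w} u~w 2≤fu = reaches-weaken (on-pairs _ moved) (reaches-move (onFiber a f) (adjʳ a u~w) 2≤)
    where
    2≤ : 2 ≤ onFiber a f (pair a u)
    2≤ rewrite fst-pair a u | snd-pair a u | point-at {u = a} (f u) = 2≤fu
    moved : ∀ a' b' → onFiber a (λ y → (f y ∸ point u 2 y) + point w 1 y) (pair a' b')
                      ≤ (onFiber a f (pair a' b') ∸ point (pair a u) 2 (pair a' b')) + point (pair a w) 1 (pair a' b')
    moved a' b' rewrite fst-pair a' b' | snd-pair a' b' with a' ≟ a
    ... | yes refl rewrite point-injective (pair a') pair-injective₂ u 2 b'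
                         | point-injective (pair a') pair-injective₂ w 1 b' = ≤-refl
    ... | no _ = z≤n

  onFiber-reach : ∀ a {f f'} → Reach B f f' → Reaches X (onFiber a f) (onFiber a f')
  onFiber-reach a ε = reaches-refl _
  onFiber-reach a (move f u w u~w 2≤fu ◅ steps) = reaches-trans (onFiber-move a f u~w 2≤fu) (onFiber-reach a steps)

  onFiber-reaches : ∀ a {f g} → Reaches B f g → Reaches X (onFiber a f) (onFiber a g)
  onFiber-reaches a (f' , f⇝f' , g≼f') = reaches-weaken (λ x → point-mono (g≼f' (snd x)) (fst x)) (onFiber-reach a f⇝f')

  sumFin-onFiber-restrict : ∀ c x → sumFin (n A) (λ a → onFiber a (restrict a c) x) ≡ c x
  sumFin-onFiber-restrict c x = trans (sumFin-points (n A) (λ a → c (pair a (snd x))) (fst x)) (cong c (pair-fst-snd x))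

  sliceSum-point : ∀ j a b k → sliceSum j (point (pair a b) k) ≡ point a k j
  sliceSum-point j a b k with j ≟ a
  ... | yes refl = trans (sumFin-cong (n B) (λ b' → point-injective (pair j) pair-injective₂ b k b')) (sumFin-point (n B) b k)
  ... | no j≢a = sumFin-zero (n B) (λ b' → point-off k (j≢a ∘ pair-injective₁))

  sliceSum-point-⊕ : ∀ j a b k c → sliceSum j (point (pair a b) k ⊕ c) ≡ point a k j + sliceSum j c
  sliceSum-point-⊕ j a b k c = trans (sumFin-⊕ (n B) _ (restrict j c)) (cong (_+ sliceSum j c) (sliceSum-point j a b k))

module _ {A B X : Graph} (P : Product A B X) where
  open Product P
  open Fibers P
  private module Fibersᵀ = Fibers (swap P)

  gather : ∀ {p q} → PebblingProp B p → PebblingProp A q → ∀ rA rB c (k : Fin (n A) → ℕ) →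
           (∀ a → p * k a ≤ sliceSum a c) → q ≤ sumFin (n A) k → Solvable X c (pair rA rB)
  gather {q = q} pebB pebA rA rB c k pk≤ q≤Σk =
    reaches⇒solvable (pair rA rB) (reaches-weaken root-covered (reaches-trans fibers-pebbled column-pebbled))
    where
    fibers-pebbled : Reaches X c (Fibersᵀ.onFiber rB k)
    fibers-pebbled =
      reaches-mono (λ x → ≤-reflexive (sumFin-onFiber-restrict c x))
        (reaches-weaken (λ x → ≤-reflexive (sym (sumFin-points (n A) (λ a → point rB (k a) (snd x)) (fst x))))
          (reaches-sumFin (n A) _ _ λ a → onFiber-reaches a (reaches-pebbles pebB rB (k a) (restrict a c) (pk≤ a))))
    column-pebbled : Reaches X (Fibersᵀ.onFiber rB k) (Fibersᵀ.onFiber rB (point rA 1))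
    column-pebbled = Fibersᵀ.onFiber-reaches rB (reaches-pebbles pebA rA 1 k (≤-trans (≤-reflexive (*-identityʳ q)) q≤Σk))
    root-covered : point (pair rA rB) 1 ≼ Fibersᵀ.onFiber rB (point rA 1)
    root-covered x = ≤-reflexive (sym (Fibersᵀ.onFiber-point rB rA 1 x))

module Shipping {A B X : Graph} (P : Product A B X) (v : Fin (n A)) where
  open Product P
  open Fibers P
  private module Fibersᵀ = Fibers (swap P)

  record Shipment (c : Conf X) (cost : ℕ) (gain : Fin (n A) → ℕ) : Set where
    field
      result : Conf X
      reaches : Reaches X c result
      paid : sliceSum v c ≤ sliceSum v result + cost
      received : ∀ j → j ≢ v → sliceSum j c + gain j ≤ sliceSum j result
  open Shipment

  shipment-none : ∀ c → Shipment c 0 (λ _ → 0)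
  shipment-none c = record
    { result = c ; reaches = reaches-refl c ; paid = m≤m+n _ 0 ; received = λ j _ → ≤-reflexive (+-identityʳ _) }

  shipment-weaken : ∀ {c t g g'} → g' ≼ g → Shipment c t g → Shipment c t g'
  shipment-weaken g'≼g s = record
    { result = result s ; reaches = reaches s ; paid = paid s
    ; received = λ j j≢v → ≤-trans (+-monoʳ-≤ _ (g'≼g j)) (received s j j≢v) }

  -- The slice of v must keep a reserve of r pebbles throughout, for the pigeonhole step.
  ship-then : ∀ {c t t' g g'} r → r + (t + t') ≤ sliceSum v c → (s : Shipment c t g) →
              (∀ c' → r + t' ≤ sliceSum v c' → Shipment c' t' g') → Shipment c (t + t') (g ⊕ g')
  ship-then {c} {t} {t'} {g} {g'} r r+t+t'≤ s next = record
    { result = result s'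
    ; reaches = reaches-trans (reaches s) (reaches s')
    ; paid = begin
        sliceSum v c                          ≤⟨ paid s ⟩
        sliceSum v (result s) + t             ≤⟨ +-monoˡ-≤ t (paid s') ⟩
        sliceSum v (result s') + t' + t       ≡⟨ +-assoc _ t' t ⟩
        sliceSum v (result s') + (t' + t)     ≡⟨ cong (sliceSum v (result s') +_) (+-comm t' t) ⟩
        sliceSum v (result s') + (t + t')     ∎
    ; received = λ j j≢v → begin
        sliceSum j c + (g j + g' j)           ≡⟨ +-assoc (sliceSum j c) (g j) (g' j) ⟨
        sliceSum j c + g j + g' j             ≤⟨ +-monoˡ-≤ (g' j) (received s j j≢v) ⟩
        sliceSum j (result s) + g' j          ≤⟨ received s' j j≢v ⟩
        sliceSum j (result s')                ∎ }
    where
    open ≤-Reasoning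
    r+t'≤ : r + t' ≤ sliceSum v (result s)
    r+t'≤ = +-cancelʳ-≤ t _ _ (begin
      r + t' + t          ≡⟨ +-assoc r t' t ⟩
      r + (t' + t)        ≡⟨ cong (r +_) (+-comm t' t) ⟩
      r + (t + t')        ≤⟨ r+t+t'≤ ⟩
      sliceSum v c        ≤⟨ paid s ⟩
      sliceSum v (result s) + t ∎)
    s' = next (result s) r+t'≤

  ship-pebble : ∀ {w ℓ} → Walk A v w ℓ → ∀ c i → 2 ^ ℓ ≤ c (pair v i) → Shipment c (2 ^ ℓ) (point w 1)
  ship-pebble {w} {ℓ} walk c i 2^ℓ≤ = record
    { result = point (pair w i) 1 ⊕ rest
    ; reaches = reaches-mono (λ x → ≤-reflexive (c-split x)) (reaches-frame rest walked)
    ; paid = begin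
        sliceSum v c                                    ≡⟨ σ-c v ⟩
        point v (2 ^ ℓ) v + sliceSum v rest             ≡⟨ cong (_+ sliceSum v rest) (point-at (2 ^ ℓ)) ⟩
        2 ^ ℓ + sliceSum v rest                         ≡⟨ +-comm (2 ^ ℓ) _ ⟩
        sliceSum v rest + 2 ^ ℓ                         ≤⟨ +-monoˡ-≤ (2 ^ ℓ) (m≤n+m _ (point w 1 v)) ⟩
        point w 1 v + sliceSum v rest + 2 ^ ℓ           ≡⟨ cong (_+ 2 ^ ℓ) (sliceSum-point-⊕ v w i 1 rest) ⟨
        sliceSum v (point (pair w i) 1 ⊕ rest) + 2 ^ ℓ  ∎
    ; received = λ j j≢v → begin
        sliceSum j c + point w 1 j                      ≡⟨ cong (_+ point w 1 j) (σ-c j) ⟩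
        point v (2 ^ ℓ) j + sliceSum j rest + point w 1 j
                                                        ≡⟨ cong (λ z → z + sliceSum j rest + point w 1 j) (point-off (2 ^ ℓ) j≢v) ⟩
        sliceSum j rest + point w 1 j                   ≡⟨ +-comm (sliceSum j rest) _ ⟩
        point w 1 j + sliceSum j rest                   ≡⟨ sliceSum-point-⊕ j w i 1 rest ⟨
        sliceSum j (point (pair w i) 1 ⊕ rest)          ∎ }
    where
    open ≤-Reasoning
    rest : Conf X
    rest x = c x ∸ point (pair v i) (2 ^ ℓ) x
    c-split : ∀ x → point (pair v i) (2 ^ ℓ) x + rest x ≡ c x
    c-split x = m+[n∸m]≡n (point-≼ 2^ℓ≤ x)
    σ-c : ∀ j → sliceSum j c ≡ point v (2 ^ ℓ) j + sliceSum j rest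
    σ-c j = trans (sumFin-cong (n B) (λ b → sym (c-split (pair j b)))) (sliceSum-point-⊕ j v i (2 ^ ℓ) rest)
    walked : Reaches X (point (pair v i) (2 ^ ℓ)) (point (pair w i) 1)
    walked =
      reaches-mono (λ x → ≤-trans (≤-reflexive (Fibersᵀ.onFiber-point i v (1 * 2 ^ ℓ) x))
                                  (point-mono (≤-reflexive (*-identityˡ (2 ^ ℓ))) x))
        (reaches-weaken (λ x → ≤-reflexive (sym (Fibersᵀ.onFiber-point i w 1 x)))
          (Fibersᵀ.onFiber-reaches i (reaches-walk walk 1)))

  ship-pebbles : ∀ {w ℓ L} → Walk A v w ℓ → 2 ^ ℓ ≤ L → ∀ u c →
                 n B * (L ∸ 1) + u * 2 ^ ℓ ≤ sliceSum v c → Shipment c (u * 2 ^ ℓ) (point w u)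
  ship-pebbles walk 2^ℓ≤L zero c _ = shipment-weaken (point-≼ z≤n) (shipment-none c)
  ship-pebbles {ℓ = ℓ} {L} walk 2^ℓ≤L (suc u) c budget =
    shipment-weaken (λ x → ≤-reflexive (point-+ 1 u x))
      (ship-then (n B * (L ∸ 1)) budget (ship-pebble walk c i 2^ℓ≤ci)
        (λ c' → ship-pebbles walk 2^ℓ≤L u c'))
    where
    full-vertex = pigeonhole (n B) (restrict v c) (2 ^ ℓ ∸ 1) (begin-strict
      n B * (2 ^ ℓ ∸ 1)                      ≤⟨ *-monoʳ-≤ (n B) (∸-monoˡ-≤ 1 2^ℓ≤L) ⟩
      n B * (L ∸ 1)                          <⟨ m<m+n _ (≤-trans (m^n>0 2 ℓ) (m≤m+n (2 ^ ℓ) (u * 2 ^ ℓ))) ⟩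
      n B * (L ∸ 1) + suc u * 2 ^ ℓ          ≤⟨ budget ⟩
      sliceSum v c                           ∎)
      where open ≤-Reasoning
    i = proj₁ full-vertex
    2^ℓ≤ci : 2 ^ ℓ ≤ c (pair v i)
    2^ℓ≤ci = subst (_≤ c (pair v i)) (suc-pred (2 ^ ℓ) {{m^n≢0 2 ℓ}}) (proj₂ full-vertex)

  module _ (D : Fin (n A) → Fin (n A) → ℕ) (dist : IsDistance A D) (d : ℕ) where

    ship-to : ∀ w u c → u ≡ 0 ⊎ D v w ≤ d → n B * (2 ^ d ∸ 1) + u * 2 ^ D v w ≤ sliceSum v c →
              Shipment c (u * 2 ^ D v w) (point w u)
    ship-to w u c (inj₁ refl) _ = shipment-weaken (point-≼ z≤n) (shipment-none c)
    ship-to w u c (inj₂ Dvw≤d) = ship-pebbles (proj₁ (dist v w)) (^-monoʳ-≤ 2 Dvw≤d) u c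

    ship-all : ∀ m (w : Fin m → Fin (n A)) (u : Fin m → ℕ) c → (∀ k → u k ≡ 0 ⊎ D v (w k) ≤ d) →
               n B * (2 ^ d ∸ 1) + sumFin m (λ k → u k * 2 ^ D v (w k)) ≤ sliceSum v c →
               Shipment c (sumFin m (λ k → u k * 2 ^ D v (w k))) (λ j → sumFin m (λ k → point (w k) (u k) j))
    ship-all zero w u c _ _ = shipment-none c
    ship-all (suc m) w u c near budget =
      ship-then (n B * (2 ^ d ∸ 1)) budget
        (ship-to (w zero) (u zero) c (near zero) (≤-trans (+-monoʳ-≤ (n B * (2 ^ d ∸ 1)) (m≤m+n _ _)) budget))
        (λ c' → ship-all m (w ∘ suc) (u ∘ suc) c' (near ∘ suc))

module _ (G H : Graph) where

  private
    coordinates : ∀ g h → quotRem {n G} (n H) (combine g h) ≡ (h , g)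
    coordinates g h = cong ×-swap (remQuot-combine g h)

    equal-and : ∀ {m} (i : Fin m) {b} → T b → T (⌊ i ≟ i ⌋ ∧ b)
    equal-and i t = Equivalence.from T-∧ (fromWitness refl , t)

  □-product : Product G H (G □ H)
  □-product = record
    { pair = combine
    ; fst = λ x → proj₁ (remQuot {n G} (n H) x)
    ; snd = λ x → proj₂ (remQuot {n G} (n H) x)
    ; fst-pair = λ g h → cong proj₂ (coordinates g h)
    ; snd-pair = λ g h → cong proj₁ (coordinates g h)
    ; pair-fst-snd = combine-remQuot {n G} (n H)
    ; adjˡ = λ {g} {g'} h g~g' →
        adj-from (coordinates g h) (coordinates g' h) (Equivalence.from T-∨ (inj₂ (equal-and h g~g')))
    ; adjʳ = λ g {h} {h'} h~h' →
        adj-from (coordinates g h) (coordinates g h') (Equivalence.from T-∨ (inj₁ (equal-and g h~h')))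
    }
    where
    adj-from : ∀ {x y g h g' h'} → quotRem {n G} (n H) x ≡ (h , g) → quotRem {n G} (n H) y ≡ (h' , g') →
               T ((⌊ g ≟ g' ⌋ ∧ E H h h') ∨ (⌊ h ≟ h' ⌋ ∧ E G g g')) → Adj (G □ H) x y
    adj-from eqx eqy t rewrite eqx | eqy = t

side-product : ∀ s G H → Product (Kbar s G H) (Kof s G H) (G □ H)
side-product sideG G H = swap (□-product G H)
side-product sideH G H = □-product G H

slice-total≡sliceSum : ∀ s G H π c j → Slices.c~ s G H π c j ≡ Fibers.sliceSum (side-product s G H) j c
slice-total≡sliceSum sideG G H π c j = refl
slice-total≡sliceSum sideH G H π c j = refl

module Bound (s : Side) (G H : Graph) (π π̄ M : ℕ)
  (peb : PebblingProp (Kof s G H) π) (peb̄ : PebblingProp (Kbar s G H) π̄) (ππ̄≤M : π * π̄ ≤ M)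
  (rA : Fin (n (Kbar s G H))) (rB : Fin (n (Kof s G H)))
  (D : Fin (n (Kbar s G H)) → Fin (n (Kbar s G H)) → ℕ) (dist : IsDistance (Kbar s G H) D)
  (v : Fin (n (Kbar s G H))) (η : ℕ) (1≤η : 1 ≤ η)
  (S : Subset (n (Kbar s G H))) (v∉S : v ∉ S) (η≤∣S∣ : η ≤ ∣ S ∣) (∣S∣≤π̄ : ∣ S ∣ ≤ π̄)
  (c : Conf (G □ H)) (unsolvable : ¬ Solvable (G □ H) c (Product.pair (side-product s G H) rA rB))
  where

  open Slices s G H π c
  open Product (side-product s G H) using (pair)
  open Fibers (side-product s G H) using (sliceSum)
  open Shipping (side-product s G H) v

  N = n K
  d = maxIn S (D v)
  a = ∣ S ∣ ∸ η
  χ = (2 ^ d ∸ 1) + ∣ S ∣ ∸ η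
  cost = sumIn S (λ w → 2 ^ D v w * (π ∸ extra w))

  N≤π : N ≤ π
  N≤π = order≤pebbling peb rB

  c~-split : ∀ j → π * set j + extra j ≡ c~ j
  c~-split j = m+[n∸m]≡n (*-div0-≤ (c~ j) π)

  sliceSum-split : ∀ j → π * set j + extra j ≡ sliceSum j c
  sliceSum-split j = trans (c~-split j) (slice-total≡sliceSum s G H π c j)

  extra<π : ∀ j → extra j < π
  extra<π j = ∸-*-div0-< (c~ j) π (≤-trans (>-nonZero⁻¹ N {{nonZeroIndex rB}}) N≤π)

  lhs≤M : N * a + extra v + 1 ≤ M
  lhs≤M = begin
    N * a + extra v + 1   ≡⟨ +-assoc (N * a) (extra v) 1 ⟩
    N * a + (extra v + 1) ≤⟨ +-mono-≤ (*-monoˡ-≤ a N≤π) (≤-trans (≤-reflexive (+-comm (extra v) 1)) (extra<π v)) ⟩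
    π * a + π             ≡⟨ cong (π * a +_) (*-identityʳ π) ⟨
    π * a + π * 1         ≡⟨ *-distribˡ-+ π a 1 ⟨
    π * (a + 1)           ≤⟨ *-monoʳ-≤ π (≤-trans (+-monoʳ-≤ a 1≤η) (≤-trans (≤-reflexive (m∸n+n≡m η≤∣S∣)) ∣S∣≤π̄)) ⟩
    π * π̄                 ≤⟨ ππ̄≤M ⟩
    M                     ∎
    where open ≤-Reasoning

  module _ (χ≤sat : χ ≤ sat v) (enough-sets : π̄ ∸ η ≤ sumFin (n Kb) set) (cost≤ : cost ≤ N * a + extra v) where

    demand : Fin (n Kb) → ℕ
    demand w = if lookup S w then π ∸ extra w else 0

    near : ∀ w → demand w ≡ 0 ⊎ D v w ≤ d
    near w with lookup S w in w∈S
    ... | true = inj₂ (maxIn-ub S (D v) w∈S)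
    ... | false = inj₁ refl

    demand-cost : sumFin (n Kb) (λ w → demand w * 2 ^ D v w) ≡ cost
    demand-cost = sumFin-cong (n Kb) λ w → if-* (lookup S w) (π ∸ extra w) (2 ^ D v w)
      where
      if-* : ∀ (b : Bool) x y → (if b then x else 0) * y ≡ (if b then y * x else 0)
      if-* true x y = *-comm x y
      if-* false x y = refl

    reserve : N * (2 ^ d ∸ 1) + cost ≤ sliceSum v c
    reserve = begin
      N * (2 ^ d ∸ 1) + cost                   ≤⟨ +-monoʳ-≤ (N * (2 ^ d ∸ 1)) cost≤ ⟩
      N * (2 ^ d ∸ 1) + (N * a + extra v)      ≡⟨ +-assoc (N * (2 ^ d ∸ 1)) (N * a) (extra v) ⟨
      N * (2 ^ d ∸ 1) + N * a + extra v        ≡⟨ cong (_+ extra v) (*-distribˡ-+ N (2 ^ d ∸ 1) a) ⟨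
      N * ((2 ^ d ∸ 1) + a) + extra v          ≡⟨ cong (λ t → N * t + extra v) (+-∸-assoc (2 ^ d ∸ 1) η≤∣S∣) ⟨
      N * χ + extra v                          ≤⟨ +-monoˡ-≤ (extra v) (*-monoʳ-≤ N χ≤sat) ⟩
      N * sat v + extra v                      ≤⟨ +-monoˡ-≤ (extra v) N*sat≤ ⟩
      π * set v + extra v                      ≡⟨ sliceSum-split v ⟩
      sliceSum v c                             ∎
      where
      open ≤-Reasoning
      N*sat≤ : N * sat v ≤ π * set v
      N*sat≤ = ≤-trans (*-div0-≤ (c~ v ∸ extra v) N)
                 (≤-reflexive (trans (cong (_∸ extra v) (sym (c~-split v))) (m+n∸n≡m (π * set v) (extra v))))

    shipment : Shipment c cost demand
    shipment = subst (λ t → Shipment c t demand) demand-cost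
      (shipment-weaken (λ j → ≤-reflexive (sym (sumFin-points (n Kb) demand j)))
        (ship-all D dist d (n Kb) (λ w → w) demand c near (subst (λ t → N * (2 ^ d ∸ 1) + t ≤ sliceSum v c) (sym demand-cost) reserve)))

    open Shipment shipment

    -- The number of π-sets each slice contributes; v gives up the |S| − η sets spent on shipping.
    k : Fin (n Kb) → ℕ
    k j = (if lookup S j then 1 else 0) + set j ∸ point v a j

    member-bound : ∀ j → π * ((if lookup S j then 1 else 0) + set j) ≤ sliceSum j c + demand j
    member-bound j with lookup S j
    ... | true = ≤-reflexive (begin
      π * suc (set j)                             ≡⟨ *-suc π (set j) ⟩
      π + π * set j                               ≡⟨ cong (_+ π * set j) (m+[n∸m]≡n (<⇒≤ (extra<π j))) ⟨
      extra j + (π ∸ extra j) + π * set j         ≡⟨ +-comm _ (π * set j) ⟩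
      π * set j + (extra j + (π ∸ extra j))       ≡⟨ +-assoc (π * set j) (extra j) _ ⟨
      π * set j + extra j + (π ∸ extra j)         ≡⟨ cong (_+ (π ∸ extra j)) (sliceSum-split j) ⟩
      sliceSum j c + (π ∸ extra j)                ∎)
      where open ≡-Reasoning
    ... | false = ≤-trans (m≤m+n (π * set j) (extra j))
                    (≤-reflexive (trans (sliceSum-split j) (sym (+-identityʳ (sliceSum j c)))))

    πk≤ : ∀ j → π * k j ≤ sliceSum j result
    πk≤ j with j ≟ v
    ... | yes refl = begin
      π * ((if lookup S v then 1 else 0) + set v ∸ a)  ≡⟨ cong (λ b → π * ((if b then 1 else 0) + set v ∸ a)) (∉⇒lookup≡false S v∉S) ⟩
      π * (set v ∸ a)                              ≡⟨ *-distribˡ-∸ π (set v) a ⟩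
      π * set v ∸ π * a                            ≤⟨ m≤n+o⇒m∸n≤o (π * set v) (π * a) (+-cancelʳ-≤ (extra v) _ _ kept) ⟩
      sliceSum v result                            ∎
      where
      open ≤-Reasoning
      kept : π * set v + extra v ≤ π * a + sliceSum v result + extra v
      kept = begin
        π * set v + extra v                        ≡⟨ sliceSum-split v ⟩
        sliceSum v c                               ≤⟨ paid ⟩
        sliceSum v result + cost                   ≤⟨ +-monoʳ-≤ (sliceSum v result) (≤-trans cost≤ (+-monoˡ-≤ (extra v) (*-monoˡ-≤ a N≤π))) ⟩
        sliceSum v result + (π * a + extra v)      ≡⟨ +-assoc (sliceSum v result) (π * a) (extra v) ⟨
        sliceSum v result + π * a + extra v        ≡⟨ cong (_+ extra v) (+-comm (sliceSum v result) (π * a)) ⟩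
        π * a + sliceSum v result + extra v        ∎
    ... | no j≢v = begin
      π * ((if lookup S j then 1 else 0) + set j)  ≤⟨ member-bound j ⟩
      sliceSum j c + demand j                      ≤⟨ received j j≢v ⟩
      sliceSum j result                            ∎
      where open ≤-Reasoning

    π̄≤Σk : π̄ ≤ sumFin (n Kb) k
    π̄≤Σk = +-cancelˡ-≤ a _ _ (begin
      a + π̄                                                    ≡⟨ cong (a +_) (m+[n∸m]≡n (≤-trans η≤∣S∣ ∣S∣≤π̄)) ⟨
      a + (η + (π̄ ∸ η))                                        ≡⟨ +-assoc a η _ ⟨
      a + η + (π̄ ∸ η)                                          ≡⟨ cong (_+ (π̄ ∸ η)) (m∸n+n≡m η≤∣S∣) ⟩
      ∣ S ∣ + (π̄ ∸ η)                                          ≤⟨ +-monoʳ-≤ ∣ S ∣ enough-sets ⟩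
      ∣ S ∣ + sumFin (n Kb) set                                ≡⟨ cong (_+ sumFin (n Kb) set) (sumIn-one S) ⟨
      sumIn S (λ _ → 1) + sumFin (n Kb) set                    ≡⟨ sumFin-⊕ (n Kb) _ set ⟨
      sumFin (n Kb) (λ j → (if lookup S j then 1 else 0) + set j)
                                                               ≤⟨ sumFin-mono (n Kb) (λ j → m≤n+m∸n _ (point v a j)) ⟩
      sumFin (n Kb) (point v a ⊕ k)                            ≡⟨ sumFin-⊕ (n Kb) (point v a) k ⟩
      sumFin (n Kb) (point v a) + sumFin (n Kb) k              ≡⟨ cong (_+ sumFin (n Kb) k) (sumFin-point (n Kb) v a) ⟩
      a + sumFin (n Kb) k                                      ∎)
      where open ≤-Reasoning

    solvable : Solvable (G □ H) c (pair rA rB)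
    solvable = reaches⇒solvable (pair rA rB) (reaches-trans reaches
      (solvable⇒reaches (pair rA rB) (gather (side-product s G H) peb peb̄ rA rB result k πk≤ π̄≤Σk)))

  bound : N * a + extra v + 1 ≤ cost + M * (1 ∸ x v χ) + M * (1 ∸ y (π̄ ∸ η))
  bound with indicator-cases χ (sat v) | indicator-cases (π̄ ∸ η) (sumFin (n Kb) set)
  ... | inj₁ x≡0 | _ = begin
    N * a + extra v + 1                               ≤⟨ lhs≤M ⟩
    M                                                 ≡⟨ *-identityʳ M ⟨
    M * 1                                             ≡⟨ cong (λ t → M * (1 ∸ t)) x≡0 ⟨
    M * (1 ∸ x v χ)                                   ≤⟨ m≤n+m _ cost ⟩
    cost + M * (1 ∸ x v χ)                            ≤⟨ m≤m+n _ _ ⟩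
    cost + M * (1 ∸ x v χ) + M * (1 ∸ y (π̄ ∸ η))     ∎
    where open ≤-Reasoning
  ... | inj₂ _ | inj₁ y≡0 = begin
    N * a + extra v + 1                               ≤⟨ lhs≤M ⟩
    M                                                 ≡⟨ *-identityʳ M ⟨
    M * 1                                             ≡⟨ cong (λ t → M * (1 ∸ t)) y≡0 ⟨
    M * (1 ∸ y (π̄ ∸ η))                               ≤⟨ m≤n+m _ _ ⟩
    cost + M * (1 ∸ x v χ) + M * (1 ∸ y (π̄ ∸ η))     ∎
    where open ≤-Reasoning
  ... | inj₂ χ≤sat | inj₂ enough-sets with cost ≤? N * a + extra v
  ...   | yes cost≤ = ⊥-elim (unsolvable (solvable χ≤sat enough-sets cost≤))
  ...   | no cost≰ = begin
    N * a + extra v + 1                               ≡⟨ +-comm _ 1 ⟩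
    suc (N * a + extra v)                             ≤⟨ ≰⇒> cost≰ ⟩
    cost                                              ≤⟨ m≤m+n cost _ ⟩
    cost + M * (1 ∸ x v χ)                            ≤⟨ m≤m+n _ _ ⟩
    cost + M * (1 ∸ x v χ) + M * (1 ∸ y (π̄ ∸ η))     ∎
    where open ≤-Reasoning

theorem2 : (G H : Graph) → SimpleGraph G → SimpleGraph H → Connected G → Connected H →
    (πG πH : ℕ) → IsPebblingNumber G πG → IsPebblingNumber H πH →
    (rG : Fin (n G)) (rH : Fin (n H)) →
    (s : Side) →
    (D : Fin (n (Kbar s G H)) → Fin (n (Kbar s G H)) → ℕ) → IsDistance (Kbar s G H) D →
    (v : Fin (n (Kbar s G H))) (η : ℕ) → 1 ≤ η → η ≤ sel s πH πG →
    (S : Subset (n (Kbar s G H))) → v ∉ S →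
    suc (maxIn S (D v)) ≤ ⌈log₂ sel s πG πH ⌉ →
    η ≤ ∣ S ∣ → ∣ S ∣ ≤ sel s πH πG →
    (c : Conf (G □ H)) → ¬ Solvable (G □ H) c (combine rG rH) →
    let open Slices s G H (sel s πG πH) c
        d = maxIn S (D v)
        χ = (2 ^ d ∸ 1) + ∣ S ∣ ∸ η
        M = 2 * πG * πH
    in n (Kof s G H) * (∣ S ∣ ∸ η) + extra v + 1
       ≤ sumIn S (λ w → 2 ^ D v w * (sel s πG πH ∸ extra w))
         + M * (1 ∸ x v χ) + M * (1 ∸ y (sel s πH πG ∸ η))
theorem2 G H _ _ _ _ πG πH (pebG , _) (pebH , _) rG rH sideG D dist v η 1≤η _ S v∉S _ η≤∣S∣ ∣S∣≤πH c unsolvable =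
  Bound.bound sideG G H πG πH (2 * πG * πH) pebG pebH (*-monoˡ-≤ πH (m≤m+n πG _))
    rH rG D dist v η 1≤η S v∉S η≤∣S∣ ∣S∣≤πH c unsolvable
theorem2 G H _ _ _ _ πG πH (pebG , _) (pebH , _) rG rH sideH D dist v η 1≤η _ S v∉S _ η≤∣S∣ ∣S∣≤πG c unsolvable =
  Bound.bound sideH G H πH πG (2 * πG * πH) pebH pebG (≤-trans (≤-reflexive (*-comm πH πG)) (*-monoˡ-≤ πH (m≤m+n πG _)))
    rG rH D dist v η 1≤η S v∉S η≤∣S∣ ∣S∣≤πG c unsolvable
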